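{- Let $a,b\geqslant2$ be coprime integers, $\alpha=\frac AQ$ rational, $M_1$ a positive integer, and $s\leqslant n$ positive integers. Put $M_2=M_1a^{n-s}$. Suppose $x^*\in\{0,\dots,a^n-1\}$ and there exists $\eta\in\Sigma_\alpha(M_1)$ with $\frac{x^*}{a^n}\leqslant\eta<\frac{x^*+1}{a^n}$. Then for the integer $x\in\{0,\dots,a^s-1\}$ with $x\equiv x^*\pmod{a^s}$ there exists $\eta_1\in\Sigma_\alpha(M_2)$ with $\frac{x}{a^s}\leqslant\eta_1<\frac{x+1}{a^s}$. In particular, $\mathfrak{X}_{n,s}^{M_1}\subset\mathfrak{X}_s^{M_2}$.
   Context: $\Sigma=\{a^ub^v:\ u,v \text{ nonnegative integers}\}$, $\Sigma(M)=\{q\in\Sigma:\ q\leqslant M\}$, $\Sigma_\alpha(M)=\{\{q\alpha\}:\ q\in\Sigma(M)\}$ with $\{\cdot\}$ the fractional part. For positive integers $R,m$: $\mathfrak{X}_m^R=\{x\in\mathbb{Z}:\ 0\leqslant x\leqslant a^m-1,\ \exists\eta\in\Sigma_\alpha(R),\ \frac{x}{a^m}\leqslant\eta<\frac{x+1}{a^m}\}$, and for $s\leqslant n$, $\mathfrak{X}_{n,s}^R=\{x\in\mathbb{Z}:\ 0\leqslant x\leqslant a^s-1,\ \exists x^*\in\mathfrak{X}_n^R,\ x\equiv x^*\pmod{a^s}\}$. -}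

module Defs where

open import Data.Nat using (ℕ; _+_; _*_; _^_; _≤_; _<_; NonZero; _%_)
open import Data.Nat.Properties using (m^n≢0)
open import Data.Product using (Σ; ∃; _×_)
open import Relation.Binary.PropositionalEquality using (_≡_)
open import Data.Rational as ℚ using (ℚ; floor; _/_)
import Data.Integer as ℤ

frac : ℚ → ℚ
frac r = r ℚ.- (floor r / 1)

nℚ : ℕ → ℚ
nℚ k = ℤ.+ k / 1

InΣ : ℕ → ℕ → ℕ → Set
InΣ a b q = ∃ λ u → ∃ λ v → q ≡ a ^ u * b ^ v

InΣM : ℕ → ℕ → ℕ → ℕ → Set
InΣM a b M q = InΣ a b q × q ≤ M

InΣα : ℕ → ℕ → ℚ → ℕ → ℚ → Set
InΣα a b α M η = ∃ λ q → InΣM a b M q × η ≡ frac (nℚ q ℚ.* α)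

Hits : (a b : ℕ) .{{_ : NonZero a}} → ℚ → ℕ → ℕ → ℕ → Set
Hits a b α M m x =
  ∃ λ η → InΣα a b α M η
        × ((ℤ.+ x / (a ^ m)) {{m^n≢0 a m}} ℚ.≤ η)
        × (η ℚ.< (ℤ.+ (x + 1) / (a ^ m)) {{m^n≢0 a m}})

In𝔛 : (a b : ℕ) .{{_ : NonZero a}} → ℚ → ℕ → ℕ → ℕ → Set
In𝔛 a b α R m x = x < a ^ m × Hits a b α R m x

In𝔛ns : (a b : ℕ) .{{_ : NonZero a}} → ℚ → ℕ → ℕ → ℕ → ℕ → Set
In𝔛ns a b α R n s x =
  x < a ^ s × ∃ λ x* → In𝔛 a b α R n x* × (x % a ^ s) {{m^n≢0 a s}} ≡ (x* % a ^ s) {{m^n≢0 a s}}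

{-# OPTIONS --safe #-}
-- Write x* = x + k a^s and N = a^(n-s), so that a^n = a^s N. If η = {qα} lies in
-- [x*/a^n, (x*+1)/a^n), then Nη - k lies in [x/a^s, (x+1)/a^s) ⊆ [0,1), and since
-- qNα - (Nη - k) is an integer, {qNα} = Nη - k. As qN = a^(u+n-s) b^v ≤ M₁ N,
-- the point {qNα} of Σ_α(M₁ a^(n-s)) witnesses x.
module Submission where

open import Defs
open import Data.Nat using (ℕ; _*_; _^_; _∸_; _≤_; _<_; NonZero; _%_)
open import Data.Nat.Properties using (m^n≢0)
open import Data.Nat.Coprimality using (Coprime)
open import Data.Product using (_×_)
open import Relation.Binary.PropositionalEquality using (_≡_)
open import Data.Rational using (ℚ)

open import Data.Nat as ℕ using (suc; _+_; _/_)
import Data.Nat.Properties as ℕP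
import Data.Nat.DivMod as ℕD
open import Data.Integer as ℤ using (+_)
import Data.Integer.Properties as ℤP
import Data.Integer.DivMod as ℤD
import Data.Integer.Solver as ℤS
open import Data.Rational as ℚ using (mkℚ; floor; toℚᵘ; 0ℚ; 1ℚ)
import Data.Rational.Properties as ℚP
open import Data.Rational.Solver using (module +-*-Solver)
open import Data.Rational.Unnormalised as ℚᵘ using (mkℚᵘ; *≤*; *<*; *≡*)
import Data.Rational.Unnormalised.Properties as ℚᵘP
open import Data.Product using (_,_; proj₁; proj₂)
open import Relation.Binary.PropositionalEquality using (refl; sym; trans; cong; cong₂; subst; subst₂; module ≡-Reasoning)

toℚᵘ-/ : ∀ i n .{{_ : NonZero n}} → toℚᵘ (i ℚ./ n) ℚᵘ.≃ mkℚᵘ i (ℕ.pred n)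
toℚᵘ-/ i (suc n) = ℚP.toℚᵘ-fromℚᵘ (mkℚᵘ i n)

*≤*⇒/≤/ : ∀ i j m n .{{_ : NonZero m}} .{{_ : NonZero n}} →
          i ℤ.* + n ℤ.≤ j ℤ.* + m → i ℚ./ m ℚ.≤ j ℚ./ n
*≤*⇒/≤/ i j m@(suc _) n@(suc _) le = ℚP.toℚᵘ-cancel-≤
  (ℚᵘP.≤-respˡ-≃ (ℚᵘP.≃-sym (toℚᵘ-/ i m)) (ℚᵘP.≤-respʳ-≃ (ℚᵘP.≃-sym (toℚᵘ-/ j n)) (*≤* le)))

*<*⇒/</ : ∀ i j m n .{{_ : NonZero m}} .{{_ : NonZero n}} →
          i ℤ.* + n ℤ.< j ℤ.* + m → i ℚ./ m ℚ.< j ℚ./ n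
*<*⇒/</ i j m@(suc _) n@(suc _) lt = ℚP.toℚᵘ-cancel-<
  (ℚᵘP.<-respˡ-≃ (ℚᵘP.≃-sym (toℚᵘ-/ i m)) (ℚᵘP.<-respʳ-≃ (ℚᵘP.≃-sym (toℚᵘ-/ j n)) (*<* lt)))

/</⇒*<* : ∀ i j m n .{{_ : NonZero m}} .{{_ : NonZero n}} →
          i ℚ./ m ℚ.< j ℚ./ n → i ℤ.* + n ℤ.< j ℤ.* + m
/</⇒*<* i j m@(suc _) n@(suc _) lt
  with ℚᵘP.<-respˡ-≃ (toℚᵘ-/ i m) (ℚᵘP.<-respʳ-≃ (toℚᵘ-/ j n) (ℚP.toℚᵘ-mono-< lt))
... | *<* lt′ = lt′

*≡*⇒/≡/ : ∀ i j m n .{{_ : NonZero m}} .{{_ : NonZero n}} →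
          i ℤ.* + n ≡ j ℤ.* + m → i ℚ./ m ≡ j ℚ./ n
*≡*⇒/≡/ i j m@(suc _) n@(suc _) eq = ℚP.toℚᵘ-injective
  (ℚᵘP.≃-trans (toℚᵘ-/ i m) (ℚᵘP.≃-trans (*≡* eq) (ℚᵘP.≃-sym (toℚᵘ-/ j n))))

/-*-/ : ∀ i j m n .{{_ : NonZero m}} .{{_ : NonZero n}} →
        (i ℚ./ m) ℚ.* (j ℚ./ n) ≡ ((i ℤ.* j) ℚ./ (m * n)) {{ℕP.m*n≢0 m n}}
/-*-/ i j m@(suc _) n@(suc _) = ℚP.toℚᵘ-injective
  (ℚᵘP.≃-trans (ℚP.toℚᵘ-homo-* (i ℚ./ m) (j ℚ./ n))
  (ℚᵘP.≃-trans (ℚᵘP.*-cong (toℚᵘ-/ i m) (toℚᵘ-/ j n)) (ℚᵘP.≃-sym (toℚᵘ-/ (i ℤ.* j) (m * n)))))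

/-+-/ : ∀ i j m n .{{_ : NonZero m}} .{{_ : NonZero n}} →
        (i ℚ./ m) ℚ.+ (j ℚ./ n) ≡ ((i ℤ.* + n ℤ.+ j ℤ.* + m) ℚ./ (m * n)) {{ℕP.m*n≢0 m n}}
/-+-/ i j m@(suc _) n@(suc _) = ℚP.toℚᵘ-injective
  (ℚᵘP.≃-trans (ℚP.toℚᵘ-homo-+ (i ℚ./ m) (j ℚ./ n))
  (ℚᵘP.≃-trans (ℚᵘP.+-cong (toℚᵘ-/ i m) (toℚᵘ-/ j n))
  (ℚᵘP.≃-sym (toℚᵘ-/ (i ℤ.* + n ℤ.+ j ℤ.* + m) (m * n)))))

/1-+ : ∀ i j → (i ℤ.+ j) ℚ./ 1 ≡ i ℚ./ 1 ℚ.+ j ℚ./ 1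
/1-+ i j = sym (trans (/-+-/ i j 1 1)
  (cong (ℚ._/ 1) (cong₂ ℤ._+_ (ℤP.*-identityʳ i) (ℤP.*-identityʳ j))))

nℚ-* : ∀ m n → nℚ (m * n) ≡ nℚ m ℚ.* nℚ n
nℚ-* m n = trans (cong (ℚ._/ 1) (ℤP.pos-* m n)) (sym (/-*-/ (+ m) (+ n) 1 1))

*-cancelʳ-/ : ∀ i m n d .{{_ : NonZero m}} .{{_ : NonZero n}} .{{_ : NonZero d}} →
              d ≡ m * n → nℚ n ℚ.* (i ℚ./ d) ≡ i ℚ./ m
*-cancelʳ-/ i m n d refl = trans (/-*-/ (+ n) i 1 d) (*≡*⇒/≡/ (+ n ℤ.* i) i _ m {{ℕP.m*n≢0 1 d}} (begin
    (+ n ℤ.* i) ℤ.* + m       ≡⟨ solve 3 (λ n i m → (n :* i) :* m := i :* (m :* n)) refl (+ n) i (+ m) ⟩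
    i ℤ.* (+ m ℤ.* + n)       ≡⟨ cong (i ℤ.*_) (sym (ℤP.pos-* m n)) ⟩
    i ℤ.* + (m * n)           ≡⟨ cong (λ k → i ℤ.* + k) (sym (ℕP.*-identityˡ (m * n))) ⟩
    i ℤ.* + (1 * (m * n))     ∎))
  where open ≡-Reasoning
        open ℤS.+-*-Solver

+-*-/ : ∀ i k m .{{_ : NonZero m}} → (i ℤ.+ + k ℤ.* + m) ℚ./ m ≡ i ℚ./ m ℚ.+ nℚ k
+-*-/ i k m = sym (trans (/-+-/ i (+ k) m 1) (*≡*⇒/≡/ (i ℤ.* + 1 ℤ.+ + k ℤ.* + m) (i ℤ.+ + k ℤ.* + m) (m * 1) m {{ℕP.m*n≢0 m 1}} (begin
    (i ℤ.* + 1 ℤ.+ + k ℤ.* + m) ℤ.* + m   ≡⟨ solve 3 (λ i k m → (i :* con (+ 1) :+ k :* m) :* m := (i :+ k :* m) :* m) refl i (+ k) (+ m) ⟩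
    (i ℤ.+ + k ℤ.* + m) ℤ.* + m           ≡⟨ cong (λ n → (i ℤ.+ + k ℤ.* + m) ℤ.* + n) (sym (ℕP.*-identityʳ m)) ⟩
    (i ℤ.+ + k ℤ.* + m) ℤ.* + (m * 1)     ∎)))
  where open ≡-Reasoning
        open ℤS.+-*-Solver

floor-≤ : ∀ p → floor p ℚ./ 1 ℚ.≤ p
floor-≤ p@(mkℚ n d _) = subst (floor p ℚ./ 1 ℚ.≤_) (ℚP.↥p/↧p≡p p) (*≤*⇒/≤/ (floor p) n 1 (suc d) (begin
    floor p ℤ.* D                      ≤⟨ ℤP.i≤j+i _ (+ (n ℤ.% D)) ⟩
    + (n ℤ.% D) ℤ.+ floor p ℤ.* D     ≡⟨ sym (ℤD.a≡a%n+[a/n]*n n D) ⟩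
    n                                  ≡⟨ sym (ℤP.*-identityʳ n) ⟩
    n ℤ.* + 1                          ∎))
  where open ℤP.≤-Reasoning
        D = + suc d

<-floor+1 : ∀ p → p ℚ.< ℤ.suc (floor p) ℚ./ 1
<-floor+1 p@(mkℚ n d _) = subst (ℚ._< ℤ.suc (floor p) ℚ./ 1) (ℚP.↥p/↧p≡p p) (*<*⇒/</ n (ℤ.suc (floor p)) (suc d) 1 (begin-strict
    n ℤ.* + 1                          ≡⟨ ℤP.*-identityʳ n ⟩
    n                                  ≡⟨ ℤD.a≡a%n+[a/n]*n n D ⟩
    + (n ℤ.% D) ℤ.+ floor p ℤ.* D     <⟨ ℤP.+-monoˡ-< (floor p ℤ.* D) (ℤ.+<+ (ℤD.n%d<d n D)) ⟩
    D ℤ.+ floor p ℤ.* D               ≡⟨ solve 2 (λ D f → D :+ f :* D := (con (+ 1) :+ f) :* D) refl D (floor p) ⟩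
    ℤ.suc (floor p) ℤ.* D             ∎))
  where open ℤP.≤-Reasoning
        open ℤS.+-*-Solver
        D = + suc d

floor-unique : ∀ p w → w ℚ./ 1 ℚ.≤ p → p ℚ.< ℤ.suc w ℚ./ 1 → floor p ≡ w
floor-unique p w w≤p p<w+1 = ℤP.≤-antisym
  (<suc⇒≤ (ℚP.≤-<-trans (floor-≤ p) p<w+1))
  (<suc⇒≤ (ℚP.≤-<-trans w≤p (<-floor+1 p)))
  where
  <suc⇒≤ : ∀ {i j} → i ℚ./ 1 ℚ.< ℤ.suc j ℚ./ 1 → i ℤ.≤ j
  <suc⇒≤ {i} {j} lt = subst (i ℤ.≤_) (ℤP.pred-suc j) (ℤP.i<j⇒i≤pred[j]
    (subst₂ ℤ._<_ (ℤP.*-identityʳ i) (ℤP.*-identityʳ (ℤ.suc j)) (/</⇒*<* i (ℤ.suc j) 1 1 lt)))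

frac-unique : ∀ t u w → t ≡ u ℚ.+ w ℚ./ 1 → 0ℚ ℚ.≤ u → u ℚ.< 1ℚ → frac t ≡ u
frac-unique t u w refl 0≤u u<1 = begin
    t ℚ.- floor t ℚ./ 1   ≡⟨ cong (λ f → t ℚ.- f ℚ./ 1) (floor-unique t w w≤t t<w+1) ⟩
    t ℚ.- w ℚ./ 1         ≡⟨ solve 2 (λ u W → (u :+ W) :- W := u) refl u (w ℚ./ 1) ⟩
    u                     ∎
  where
  open ≡-Reasoning
  open +-*-Solver
  w≤t : w ℚ./ 1 ℚ.≤ t
  w≤t = subst₂ ℚ._≤_ (ℚP.+-identityˡ (w ℚ./ 1)) refl (ℚP.+-monoˡ-≤ (w ℚ./ 1) 0≤u)
  t<w+1 : t ℚ.< ℤ.suc w ℚ./ 1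
  t<w+1 = subst (t ℚ.<_) (sym (/1-+ (+ 1) w)) (ℚP.+-monoˡ-< (w ℚ./ 1) u<1)

rescale-window : ∀ m n d .{{_ : NonZero m}} .{{_ : NonZero n}} .{{_ : NonZero d}} → d ≡ m * n →
                 ∀ x k η → + (x + k * m) ℚ./ d ℚ.≤ η → η ℚ.< + (x + k * m + 1) ℚ./ d →
                 + x ℚ./ m ℚ.≤ nℚ n ℚ.* η ℚ.- nℚ k × nℚ n ℚ.* η ℚ.- nℚ k ℚ.< + (x + 1) ℚ./ m
rescale-window m n d d≡mn x k η lo hi =
  subst (ℚ._≤ u) (p+K-K≡p (+ x ℚ./ m)) (ℚP.+-monoˡ-≤ (ℚ.- K)
    (subst (ℚ._≤ N ℚ.* η) (scaled x) (ℚP.*-monoˡ-≤-nonNeg N {{ℚP.normalize-nonNeg n 1}} lo))) ,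
  subst (u ℚ.<_) (p+K-K≡p (+ (x + 1) ℚ./ m)) (ℚP.+-monoˡ-< (ℚ.- K)
    (subst (N ℚ.* η ℚ.<_) (trans (cong (λ y → N ℚ.* (+ y ℚ./ d)) x+km+1≡x+1+km) (scaled (x + 1)))
      (ℚP.*-monoʳ-<-pos N {{ℚP.normalize-pos n 1}} hi)))
  where
  N = nℚ n
  K = nℚ k
  u = N ℚ.* η ℚ.- K

  scaled : ∀ y → N ℚ.* (+ (y + k * m) ℚ./ d) ≡ + y ℚ./ m ℚ.+ K
  scaled y = trans (*-cancelʳ-/ (+ (y + k * m)) m n d d≡mn)
    (trans (cong (ℚ._/ m) (trans (ℤP.pos-+ y (k * m)) (cong (ℤ._+_ (+ y)) (ℤP.pos-* k m))))
           (+-*-/ (+ y) k m))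

  x+km+1≡x+1+km : x + k * m + 1 ≡ x + 1 + k * m
  x+km+1≡x+1+km = trans (ℕP.+-assoc x (k * m) 1)
    (trans (cong (_+_ x) (ℕP.+-comm (k * m) 1)) (sym (ℕP.+-assoc x 1 (k * m))))

  p+K-K≡p : ∀ p → p ℚ.+ K ℚ.- K ≡ p
  p+K-K≡p p = solve 2 (λ p K → p :+ K :- K := p) refl p K
    where open +-*-Solver

frac-scale : ∀ m n d .{{_ : NonZero m}} .{{_ : NonZero n}} .{{_ : NonZero d}} → d ≡ m * n →
             ∀ x k t → x < m →
             + (x + k * m) ℚ./ d ℚ.≤ frac t → frac t ℚ.< + (x + k * m + 1) ℚ./ d →
             + x ℚ./ m ℚ.≤ frac (nℚ n ℚ.* t) × frac (nℚ n ℚ.* t) ℚ.< + (x + 1) ℚ./ m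
frac-scale m n d d≡mn x k t x<m lo hi =
  subst (X ℚ.≤_) (sym frac≡u) X≤u , subst (ℚ._< X′) (sym frac≡u) u<X′
  where
  N = nℚ n
  K = nℚ k
  X = + x ℚ./ m
  X′ = + (x + 1) ℚ./ m
  u = N ℚ.* frac t ℚ.- K

  X≤u : X ℚ.≤ u
  X≤u = proj₁ (rescale-window m n d d≡mn x k (frac t) lo hi)

  u<X′ : u ℚ.< X′
  u<X′ = proj₂ (rescale-window m n d d≡mn x k (frac t) lo hi)

  X′≤1 : X′ ℚ.≤ 1ℚ
  X′≤1 = *≤*⇒/≤/ (+ (x + 1)) (+ 1) m 1
    (subst₂ ℤ._≤_ (sym (ℤP.*-identityʳ (+ (x + 1)))) (sym (ℤP.*-identityˡ (+ m)))
      (ℤ.+≤+ (subst (_≤ m) (ℕP.+-comm 1 x) x<m)))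

  w = + k ℤ.+ + n ℤ.* floor t

  N*t≡u+w : N ℚ.* t ≡ u ℚ.+ w ℚ./ 1
  N*t≡u+w = begin
      N ℚ.* t                                 ≡⟨ solve 4 (λ N t F K → N :* t := (N :* (t :- F) :- K) :+ (K :+ N :* F)) refl N t (floor t ℚ./ 1) K ⟩
      u ℚ.+ (K ℚ.+ N ℚ.* (floor t ℚ./ 1))     ≡⟨ cong (λ z → u ℚ.+ (K ℚ.+ z)) (/-*-/ (+ n) (floor t) 1 1) ⟩
      u ℚ.+ (K ℚ.+ (+ n ℤ.* floor t) ℚ./ 1)   ≡⟨ cong (u ℚ.+_) (sym (/1-+ (+ k) (+ n ℤ.* floor t))) ⟩
      u ℚ.+ w ℚ./ 1                           ∎
    where open ≡-Reasoning
          open +-*-Solver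

  frac≡u : frac (N ℚ.* t) ≡ u
  frac≡u = frac-unique (N ℚ.* t) u w N*t≡u+w
    (ℚP.≤-trans (ℚP.nonNegative⁻¹ X {{ℚP.normalize-nonNeg x m}}) X≤u)
    (ℚP.<-≤-trans u<X′ X′≤1)

InΣM-*-^ : ∀ {a b M q} e → InΣM a b M q → InΣM a b (M * a ^ e) (q * a ^ e)
InΣM-*-^ {a} {b} {M} {q} e ((u , v , q≡) , q≤M) = (u + e , v , q*aᵉ≡) , ℕP.*-monoˡ-≤ (a ^ e) q≤M
  where
  q*aᵉ≡ : q * a ^ e ≡ a ^ (u + e) * b ^ v
  q*aᵉ≡ = begin
    q * a ^ e                 ≡⟨ cong (_* a ^ e) q≡ ⟩
    a ^ u * b ^ v * a ^ e     ≡⟨ ℕP.*-assoc (a ^ u) (b ^ v) (a ^ e) ⟩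
    a ^ u * (b ^ v * a ^ e)   ≡⟨ cong (a ^ u *_) (ℕP.*-comm (b ^ v) (a ^ e)) ⟩
    a ^ u * (a ^ e * b ^ v)   ≡⟨ ℕP.*-assoc (a ^ u) (a ^ e) (b ^ v) ⟨
    a ^ u * a ^ e * b ^ v     ≡⟨ cong (_* b ^ v) (ℕP.^-distribˡ-+-* a u e) ⟨
    a ^ (u + e) * b ^ v       ∎
    where open ≡-Reasoning

x<n⇒x%n≡m%n⇒m≡x+[m/n]*n : ∀ {m n x} .{{_ : NonZero n}} → x < n → x % n ≡ m % n → m ≡ x + (m / n) * n
x<n⇒x%n≡m%n⇒m≡x+[m/n]*n {m} {n} x<n x%n≡m%n =
  trans (ℕD.m≡m%n+[m/n]*n m n) (cong (_+ (m / n) * n) (trans (sym x%n≡m%n) (ℕD.m<n⇒m%n≡m x<n)))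

Hits-coarsen : ∀ a b .{{_ : NonZero a}} α M {s n} x k → s ≤ n → x < a ^ s →
               Hits a b α M n (x + k * a ^ s) → Hits a b α (M * a ^ (n ∸ s)) s x
Hits-coarsen a b α M {s} {n} x k s≤n x<aˢ (_ , (q , q∈Σ , refl) , lo , hi) =
  frac (nℚ (q * a ^ (n ∸ s)) ℚ.* α) ,
  (q * a ^ (n ∸ s) , InΣM-*-^ (n ∸ s) q∈Σ , refl) ,
  subst (λ r → + x ℚ./ a ^ s ℚ.≤ frac r × frac r ℚ.< + (x + 1) ℚ./ a ^ s) (sym regroup)
    (frac-scale (a ^ s) (a ^ (n ∸ s)) (a ^ n) aⁿ≡aˢaⁿ⁻ˢ x k (nℚ q ℚ.* α) x<aˢ lo hi)
  where
  instance
    aˢ≢0 = m^n≢0 a s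
    aⁿ⁻ˢ≢0 = m^n≢0 a (n ∸ s)
    aⁿ≢0 = m^n≢0 a n
  aⁿ≡aˢaⁿ⁻ˢ : a ^ n ≡ a ^ s * a ^ (n ∸ s)
  aⁿ≡aˢaⁿ⁻ˢ = trans (cong (a ^_) (sym (ℕP.m+[n∸m]≡n s≤n))) (ℕP.^-distribˡ-+-* a s (n ∸ s))
  regroup : nℚ (q * a ^ (n ∸ s)) ℚ.* α ≡ nℚ (a ^ (n ∸ s)) ℚ.* (nℚ q ℚ.* α)
  regroup = trans (cong (ℚ._* α) (trans (nℚ-* q (a ^ (n ∸ s))) (ℚP.*-comm (nℚ q) _)))
                  (ℚP.*-assoc (nℚ (a ^ (n ∸ s))) (nℚ q) α)

Hits-reduce : ∀ a b .{{_ : NonZero a}} α M {s n} → s ≤ n → ∀ {x* x} → x < a ^ s →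
              (x % a ^ s) {{m^n≢0 a s}} ≡ (x* % a ^ s) {{m^n≢0 a s}} →
              Hits a b α M n x* → Hits a b α (M * a ^ (n ∸ s)) s x
Hits-reduce a b α M {s} {n} s≤n {x*} {x} x<aˢ x≡x* hit =
  Hits-coarsen a b α M x ((x* / a ^ s) {{m^n≢0 a s}}) s≤n x<aˢ
    (subst (Hits a b α M n) (x<n⇒x%n≡m%n⇒m≡x+[m/n]*n {{m^n≢0 a s}} x<aˢ x≡x*) hit)

lemma3 : (a b : ℕ) .{{_ : NonZero a}} → 2 ≤ a → 2 ≤ b → Coprime a b →
         (α : ℚ) (M₁ s n : ℕ) → 1 ≤ M₁ → 1 ≤ s → s ≤ n →
         ((x* : ℕ) → x* < a ^ n → Hits a b α M₁ n x* →
            (x : ℕ) → x < a ^ s → (x % a ^ s) {{m^n≢0 a s}} ≡ (x* % a ^ s) {{m^n≢0 a s}} →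
            Hits a b α (M₁ * a ^ (n ∸ s)) s x)
         × ((x : ℕ) → In𝔛ns a b α M₁ n s x → In𝔛 a b α (M₁ * a ^ (n ∸ s)) s x)
lemma3 a b _ _ _ α M₁ s n _ _ s≤n =
  (λ _ _ hit _ x<aˢ x≡x* → Hits-reduce a b α M₁ s≤n x<aˢ x≡x* hit) ,
  (λ _ (x<aˢ , _ , (_ , hit) , x≡x*) → x<aˢ , Hits-reduce a b α M₁ s≤n x<aˢ x≡x* hit)
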